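{- Let $D$ be a unique factorization domain with field of fractions $F$ (possibly $D=F$), $\ell\in\mathbb{N}$, and $N_1,\dots,N_\ell\in D$. Suppose $\mathcal{S}_2\cap D^2=\emptyset$. Then $|\mathcal{S}_2\cap(-D^2)|\le 1$, and $|\mathcal{S}_2\cap(-D^2)|=0$ if $-1\in F^2$.
   Context: $\mathcal{S}_2$ is the set of all products $N_1^{e_1}\cdots N_\ell^{e_\ell}$ with $e_i\in\{0,1\}$ and $(e_1,\dots,e_\ell)\neq(0,\dots,0)$. $D^2=\{d^2:d\in D\}$, $-D^2=\{ -d^2:d\in D\}$, $F^2=\{x^2:x\in F\}$. -}

module Defs where

open import Level using (_⊔_)
open import Data.Bool using (Bool; true; false; if_then_else_)
open import Data.Nat using (ℕ; zero; suc)
open import Data.Fin using (Fin; zero; suc)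
open import Data.List using (List; foldr)
open import Data.List.Relation.Unary.All using (All)
open import Data.List.Relation.Binary.Pointwise using (Pointwise)
open import Data.List.Relation.Binary.Permutation.Propositional using (_↭_)
open import Data.Product using (Σ; ∃; ∃-syntax; _×_)
open import Data.Sum using (_⊎_)
open import Relation.Nullary using (¬_)
open import Relation.Binary.PropositionalEquality using (_≡_)
open import Algebra.Bundles using (CommutativeRing)

module RingDefs {c r} (R : CommutativeRing c r) where
  open CommutativeRing R hiding (zero)

  Unit : Carrier → Set (c ⊔ r)
  Unit x = ∃[ y ] (x * y ≈ 1#)

  Associated : Carrier → Carrier → Set (c ⊔ r)
  Associated x y = ∃[ u ] (Unit u × x ≈ u * y)

  Irreducible : Carrier → Set (c ⊔ r)
  Irreducible p = ¬ (p ≈ 0#) × ¬ Unit p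
                  × (∀ a b → p ≈ a * b → Unit a ⊎ Unit b)

  prodList : List Carrier → Carrier
  prodList = foldr _*_ 1#

  record IsUFD : Set (c ⊔ r) where
    field
      nontrivial    : ¬ (1# ≈ 0#)
      noZeroDivisor : ∀ x y → x * y ≈ 0# → x ≈ 0# ⊎ y ≈ 0#
      factor        : ∀ x → ¬ (x ≈ 0#) → ¬ Unit x →
                      ∃[ ps ] (All Irreducible ps × x ≈ prodList ps)
      unique        : ∀ ps qs → All Irreducible ps → All Irreducible qs →
                      prodList ps ≈ prodList qs →
                      ∃[ qs′ ] (qs′ ↭ qs × Pointwise Associated ps qs′)

  -- product N₁^{e₁} ⋯ N_ℓ^{e_ℓ} with exponents e : Fin ℓ → Bool (true = 1, false = 0)
  prodSel : ∀ {ℓ} → (Fin ℓ → Bool) → (Fin ℓ → Carrier) → Carrier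
  prodSel {zero}  e N = 1#
  prodSel {suc ℓ} e N = (if e zero then N zero else 1#)
                        * prodSel (λ i → e (suc i)) (λ i → N (suc i))

  InS2 : ∀ {ℓ} → (Fin ℓ → Carrier) → Carrier → Set r
  InS2 {ℓ} N x = ∃[ e ] ((∃[ i ] (e i ≡ true)) × x ≈ prodSel e N)

  IsSquare : Carrier → Set (c ⊔ r)
  IsSquare x = ∃[ d ] (x ≈ d * d)

  IsNegSquare : Carrier → Set (c ⊔ r)
  IsNegSquare x = ∃[ d ] (x ≈ - (d * d))

  -- -1 ∈ F², F = field of fractions of D: (a/b)² = -1 with b ≠ 0, i.e. a·a ≈ -(b·b)
  MinusOneSquareInFrac : Set (c ⊔ r)
  MinusOneSquareInFrac = ∃[ a ] ∃[ b ] (¬ (b ≈ 0#) × a * a ≈ - (b * b))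

{-# OPTIONS --safe #-}
-- Irreducible elements of a UFD are prime, so if z c² is a square with c ≠ 0, the irreducible
-- factors of c can be cancelled one at a time from both sides: a non-square of D remains a
-- non-square in F. For x = Nᵉ and y = Nᶠ in 𝒮₂ one has x y = Nᵉ⊕ᶠ (Nᵉ∧ᶠ)², with Nᵉ⊕ᶠ ∈ 𝒮₂
-- unless e = f; if x = -a² and y = -b² then x y = (ab)², which forces e = f. If -1 = (a/b)² and
-- x = -d², then x b² = (da)², so x would be a square in F.
module Submission where

open import Defs
open import Data.Nat using (ℕ; zero; suc)
open import Data.Fin using (Fin; zero; suc)
open import Data.Product using (_×_; ∃-syntax; _,_; proj₁; map₂)
open import Relation.Nullary using (¬_; yes; no)
open import Algebra.Bundles using (CommutativeRing)

open import Data.Bool using (Bool; true; false; _xor_; _∧_; if_then_else_; _≟_)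
open import Data.Empty using (⊥-elim)
open import Data.Fin.Properties using (any?)
open import Data.List using ([]; _∷_; _++_)
open import Data.List.Membership.Propositional using (_∈_)
open import Data.List.Membership.Propositional.Properties using (∈-++⁻)
open import Data.List.Relation.Unary.All using (All; []; _∷_)
open import Data.List.Relation.Unary.All.Properties using (++⁺)
open import Data.List.Relation.Unary.Any using (here; there)
open import Data.List.Relation.Binary.Pointwise using (_∷_)
open import Data.List.Relation.Binary.Permutation.Propositional.Properties using (∈-resp-↭)
open import Data.Sum using (_⊎_; inj₁; inj₂; [_,_]′; map)
open import Function using (id; _∘_)
open import Level using (_⊔_)
open import Relation.Nullary.Decidable using (¬¬-excluded-middle)
open import Relation.Binary.PropositionalEquality as ≡ using (_≡_)

module UniqueFactorisationDomain {c r} (R : CommutativeRing c r) (ufd : RingDefs.IsUFD R) where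
  open CommutativeRing R hiding (zero)
  open RingDefs R
  open IsUFD ufd
  open import Algebra.Properties.Ring ring
    using (-‿distribˡ-*; -‿distribʳ-*; -‿involutive; x≈y⇒x∙y⁻¹≈ε; x∙y⁻¹≈ε⇒x≈y; x[y-z]≈xy-xz)
  open import Algebra.Properties.CommutativeSemigroup *-commutativeSemigroup
    using (interchange; x∙yz≈yx∙z; xy∙z≈xz∙y)
  open import Algebra.Properties.CommutativeSemigroup.Divisibility *-commutativeSemigroup
    using (_∣_; _,_; ∣ʳ-trans; x∣yx; xy≈z⇒x∣z; ∣-respʳ-≈)
  open import Algebra.Solver.Ring.NaturalCoefficients.Default commutativeSemiring
    using (solve; _:=_; _:*_)
  open import Algebra.Properties.Semiring.Divisibility semiring using (_∣0)
  open import Relation.Binary.Reasoning.Setoid setoid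

  infixl 10 _²
  _² : Carrier → Carrier
  x ² = x * x

  ²-cong : ∀ {x y} → x ≈ y → x ² ≈ y ²
  ²-cong x≈y = *-cong x≈y x≈y

  *-≉0 : ∀ {x y} → x ≉ 0# → y ≉ 0# → x * y ≉ 0#
  *-≉0 {x} {y} x≉0 y≉0 xy≈0 = [ x≉0 , y≉0 ]′ (noZeroDivisor x y xy≈0)

  *-cancelˡ : ∀ {p a b} → p ≉ 0# → p * a ≈ p * b → a ≈ b
  *-cancelˡ {p} {a} {b} p≉0 pa≈pb = x∙y⁻¹≈ε⇒x≈y a b a-b≈0
    where
    p[a-b]≈0 : p * (a - b) ≈ 0#
    p[a-b]≈0 = trans (x[y-z]≈xy-xz p a b) (x≈y⇒x∙y⁻¹≈ε pa≈pb)
    a-b≈0 : a - b ≈ 0#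
    a-b≈0 = [ (λ p≈0 → ⊥-elim (p≉0 p≈0)) , id ]′ (noZeroDivisor p (a - b) p[a-b]≈0)

  ¬IsSquare⇒≉0 : ∀ {x} → ¬ IsSquare x → x ≉ 0#
  ¬IsSquare⇒≉0 ¬square x≈0 = ¬square (0# , trans x≈0 (sym (zeroˡ 0#)))

  -x*-y≈x*y : ∀ x y → - x * - y ≈ x * y
  -x*-y≈x*y x y = begin
    - x * - y      ≈⟨ -‿distribˡ-* x (- y) ⟨
    - (x * - y)    ≈⟨ -‿cong (-‿distribʳ-* x y) ⟨
    - - (x * y)    ≈⟨ -‿involutive (x * y) ⟩
    x * y          ∎

  inverse-cancelˡ : ∀ {u v} → u * v ≈ 1# → ∀ x → v * (u * x) ≈ x
  inverse-cancelˡ {u} {v} uv≈1 x = begin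
    v * (u * x)  ≈⟨ *-assoc v u x ⟨
    (v * u) * x  ≈⟨ *-congʳ (trans (*-comm v u) uv≈1) ⟩
    1# * x       ≈⟨ *-identityˡ x ⟩
    x            ∎

  Unit-*ʳ : ∀ {x y} → Unit (x * y) → Unit y
  Unit-*ʳ {x} {y} (z , xyz≈1) = x * z , trans (x∙yz≈yx∙z y x z) xyz≈1

  Unit⇒≉0 : ∀ {u} → Unit u → u ≉ 0#
  Unit⇒≉0 {u} (v , uv≈1) u≈0 = nontrivial (begin
    1#      ≈⟨ uv≈1 ⟨
    u * v   ≈⟨ *-congʳ u≈0 ⟩
    0# * v  ≈⟨ zeroˡ v ⟩
    0#      ∎)

  ∣-cancel-unit : ∀ {x u y} → Unit u → x ∣ u * y → x ∣ y
  ∣-cancel-unit {x} {u} {y} (v , uv≈1) (q , qx≈uy) = v * q , (begin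
    (v * q) * x  ≈⟨ *-assoc v q x ⟩
    v * (q * x)  ≈⟨ *-congˡ qx≈uy ⟩
    v * (u * y)  ≈⟨ inverse-cancelˡ uv≈1 y ⟩
    y            ∎)

  Associated⇒∣ : ∀ {x y} → Associated x y → x ∣ y
  Associated⇒∣ {y = y} (u , (v , uv≈1) , x≈uy) = v , trans (*-congˡ x≈uy) (inverse-cancelˡ uv≈1 y)

  unit*-preserves-Irreducible : ∀ {w p} → Unit w → Irreducible p → Irreducible (w * p)
  unit*-preserves-Irreducible {w} {p} w-unit@(v , wv≈1) (p≉0 , ¬unit-p , split) =
    *-≉0 (Unit⇒≉0 w-unit) p≉0 , ¬unit-p ∘ Unit-*ʳ , split′
    where
    split′ : ∀ a b → w * p ≈ a * b → Unit a ⊎ Unit b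
    split′ a b wp≈ab = map (Unit-*ʳ {v}) id (split (v * a) b (begin
      p            ≈⟨ inverse-cancelˡ wv≈1 p ⟨
      v * (w * p)  ≈⟨ *-congˡ wp≈ab ⟩
      v * (a * b)  ≈⟨ *-assoc v a b ⟨
      (v * a) * b  ∎))

  prodList-++ : ∀ xs ys → prodList (xs ++ ys) ≈ prodList xs * prodList ys
  prodList-++ []       ys = sym (*-identityˡ (prodList ys))
  prodList-++ (x ∷ xs) ys = trans (*-congˡ (prodList-++ xs ys)) (sym (*-assoc x _ _))

  ∈⇒∣prodList : ∀ {q qs} → q ∈ qs → q ∣ prodList qs
  ∈⇒∣prodList {qs = x ∷ xs} (here ≡.refl) = prodList xs , *-comm (prodList xs) x
  ∈⇒∣prodList {qs = x ∷ xs} (there q∈xs) = ∣ʳ-trans (∈⇒∣prodList q∈xs) (x∣yx (prodList xs) x)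

  ∈⇒∣ : ∀ {x w q qs} → x ≈ w * prodList qs → q ∈ qs → q ∣ x
  ∈⇒∣ {w = w} x≈wqs q∈qs = ∣-respʳ-≈ (sym x≈wqs) (∣ʳ-trans (∈⇒∣prodList q∈qs) (x∣yx _ w))

  prodList-≉0 : ∀ {ps} → All Irreducible ps → prodList ps ≉ 0#
  prodList-≉0 []                   = nontrivial
  prodList-≉0 ((p≉0 , _) ∷ irr-ps) = *-≉0 p≉0 (prodList-≉0 irr-ps)

  Factorisation : Carrier → Set (c ⊔ r)
  Factorisation x = ∃[ u ] ∃[ ps ] (Unit u × All Irreducible ps × x ≈ u * prodList ps)

  -- Being zero or a unit is not decidable, so case distinctions on it are made under a double
  -- negation; this is harmless because every conclusion drawn from them is negative.
  ¬¬-zero-or-factorisation : ∀ x → ¬ ¬ (x ≈ 0# ⊎ Factorisation x)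
  ¬¬-zero-or-factorisation x k = ¬¬-excluded-middle {A = x ≈ 0#} λ where
    (yes x≈0) → k (inj₁ x≈0)
    (no x≉0)  → ¬¬-excluded-middle {A = Unit x} λ where
      (yes x-unit) → k (inj₂ (x , [] , x-unit , [] , sym (*-identityʳ x)))
      (no ¬unit)   → let (ps , irr-ps , x≈ps) = factor x x≉0 ¬unit in
        k (inj₂ (1# , ps , (1# , *-identityˡ 1#) , irr-ps , trans x≈ps (sym (*-identityˡ _))))

  irreducible-factor-associated : ∀ {p ps qs} → All Irreducible (p ∷ ps) → All Irreducible qs →
                                  prodList (p ∷ ps) ≈ prodList qs → ∃[ q ] (q ∈ qs × Associated p q)
  irreducible-factor-associated {p} {ps} {qs} irr-pps irr-qs eq
    with unique (p ∷ ps) qs irr-pps irr-qs eq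
  ... | q ∷ _ , qs′↭qs , p~q ∷ _ = q , ∈-resp-↭ qs′↭qs (here ≡.refl) , p~q

  irreducible∣prodList : ∀ {p qs} → Irreducible p → All Irreducible qs → p ∣ prodList qs →
                         ¬ ¬ (∃[ q ] (q ∈ qs × p ∣ q))
  irreducible∣prodList {p} {qs} irr-p irr-qs (t , tp≈qs) k = ¬¬-zero-or-factorisation t λ where
    (inj₁ t≈0) → prodList-≉0 irr-qs (begin
      prodList qs  ≈⟨ tp≈qs ⟨
      t * p        ≈⟨ *-congʳ t≈0 ⟩
      0# * p       ≈⟨ zeroˡ p ⟩
      0#           ∎)
    (inj₂ (w , ts , w-unit , irr-ts , t≈wts)) →
      let (q , q∈qs , wp~q) = irreducible-factor-associated
            (unit*-preserves-Irreducible w-unit irr-p ∷ irr-ts) irr-qs (begin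
              (w * p) * prodList ts  ≈⟨ xy∙z≈xz∙y w p _ ⟩
              (w * prodList ts) * p  ≈⟨ *-congʳ t≈wts ⟨
              t * p                  ≈⟨ tp≈qs ⟩
              prodList qs            ∎)
      in k (q , q∈qs , ∣ʳ-trans (x∣yx p w) (Associated⇒∣ wp~q))

  irreducible⇒prime : ∀ {p a b} → Irreducible p → p ∣ a * b → ¬ ¬ (p ∣ a ⊎ p ∣ b)
  irreducible⇒prime {p} {a} {b} irr-p p∣ab k = ¬¬-zero-or-factorisation a λ where
    (inj₁ a≈0) → k (inj₁ (∣-respʳ-≈ (sym a≈0) (p ∣0)))
    (inj₂ (u , as , u-unit , irr-as , a≈uas)) → ¬¬-zero-or-factorisation b λ where
      (inj₁ b≈0) → k (inj₂ (∣-respʳ-≈ (sym b≈0) (p ∣0)))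
      (inj₂ (v , bs , v-unit , irr-bs , b≈vbs)) →
        let ab≈uv[as++bs] : a * b ≈ u * (v * prodList (as ++ bs))
            ab≈uv[as++bs] = begin
              a * b                                   ≈⟨ *-cong a≈uas b≈vbs ⟩
              (u * prodList as) * (v * prodList bs)   ≈⟨ interchange u _ v _ ⟩
              (u * v) * (prodList as * prodList bs)   ≈⟨ *-congˡ (prodList-++ as bs) ⟨
              (u * v) * prodList (as ++ bs)           ≈⟨ *-assoc u v _ ⟩
              u * (v * prodList (as ++ bs))           ∎
            p∣as++bs = ∣-cancel-unit v-unit (∣-cancel-unit u-unit (∣-respʳ-≈ ab≈uv[as++bs] p∣ab))
        in irreducible∣prodList irr-p (++⁺ irr-as irr-bs) p∣as++bs λ (q , q∈as++bs , p∣q) →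
             k (map (λ q∈as → ∣ʳ-trans p∣q (∈⇒∣ a≈uas q∈as))
                    (λ q∈bs → ∣ʳ-trans p∣q (∈⇒∣ b≈vbs q∈bs))
                    (∈-++⁻ as q∈as++bs))

  IsSquare-unit-cancel : ∀ {z u} → Unit u → IsSquare (z * u ²) → IsSquare z
  IsSquare-unit-cancel {z} {u} (v , uv≈1) (k , zu²≈k²) = k * v , (begin
    z                  ≈⟨ *-identityʳ z ⟨
    z * 1#             ≈⟨ *-congˡ (trans (²-cong uv≈1) (*-identityˡ 1#)) ⟨
    z * (u * v) ²      ≈⟨ solve 3 (λ z u v → z :* ((u :* v) :* (u :* v)) := (z :* (u :* u)) :* (v :* v)) refl z u v ⟩
    (z * u ²) * v ²    ≈⟨ *-congʳ zu²≈k² ⟩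
    k ² * v ²          ≈⟨ interchange k k v v ⟩
    (k * v) ²          ∎)

  IsSquare-descent-step : ∀ {p z c} → Irreducible p → IsSquare (z * (p * c) ²) → ¬ ¬ IsSquare (z * c ²)
  IsSquare-descent-step {p} {z} {c} irr-p (s , z[pc]²≈s²) k =
    irreducible⇒prime irr-p (xy≈z⇒x∣z p _ pp[zc²]≈s²) λ p∣s⊎p∣s →
      let (t , tp≈s) = [ id , id ]′ p∣s⊎p∣s
      in k (t , *-cancelˡ p≉0 (*-cancelˡ p≉0 (begin
        p * (p * (z * c ²))  ≈⟨ pp[zc²]≈s² ⟩
        s ²                  ≈⟨ ²-cong tp≈s ⟨
        (t * p) ²            ≈⟨ solve 2 (λ t p → (t :* p) :* (t :* p) := p :* (p :* (t :* t))) refl t p ⟩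
        p * (p * t ²)        ∎)))
    where
    p≉0 : p ≉ 0#
    p≉0 = proj₁ irr-p
    pp[zc²]≈s² : p * (p * (z * c ²)) ≈ s ²
    pp[zc²]≈s² = trans (solve 3 (λ p z c → p :* (p :* (z :* (c :* c))) := z :* ((p :* c) :* (p :* c))) refl p z c)
                       z[pc]²≈s²

  IsSquare-descent : ∀ {z c ps} → All Irreducible ps → IsSquare (z * (prodList ps * c) ²) → ¬ ¬ IsSquare (z * c ²)
  IsSquare-descent {c = c} [] square k = k (map₂ (trans (*-congˡ (²-cong (sym (*-identityˡ c))))) square)
  IsSquare-descent {c = c} {ps = p ∷ ps} (irr-p ∷ irr-ps) square k =
    IsSquare-descent-step irr-p (map₂ (trans (*-congˡ (²-cong (sym (*-assoc p _ c))))) square) λ square′ →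
      IsSquare-descent irr-ps square′ k

  IsSquare-*²⇒¬¬IsSquare : ∀ {z c} → c ≉ 0# → IsSquare (z * c ²) → ¬ ¬ IsSquare z
  IsSquare-*²⇒¬¬IsSquare {c = c} c≉0 square k = ¬¬-zero-or-factorisation c λ where
    (inj₁ c≈0) → c≉0 c≈0
    (inj₂ (u , ps , u-unit , irr-ps , c≈ups)) →
      let psu≈c = trans (*-comm (prodList ps) u) (sym c≈ups)
      in IsSquare-descent irr-ps (map₂ (trans (*-congˡ (²-cong psu≈c))) square) λ square′ →
           k (IsSquare-unit-cancel u-unit square′)

  select : Bool → Carrier → Carrier
  select b n = if b then n else 1#

  select-* : ∀ a b n → select a n * select b n ≈ select (a xor b) n * select (a ∧ b) n ²
  select-* true  true  n = sym (*-identityˡ (n ²))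
  select-* true  false n = *-congˡ (sym (*-identityˡ 1#))
  select-* false true  n = trans (*-comm 1# n) (*-congˡ (sym (*-identityˡ 1#)))
  select-* false false n = *-congˡ (sym (*-identityˡ 1#))

  prodSel-* : ∀ {ℓ} (e f : Fin ℓ → Bool) (N : Fin ℓ → Carrier) →
              prodSel e N * prodSel f N ≈ prodSel (λ i → e i xor f i) N * prodSel (λ i → e i ∧ f i) N ²
  prodSel-* {zero}  e f N = *-congˡ (sym (*-identityˡ 1#))
  prodSel-* {suc ℓ} e f N = begin
    (α * A) * (β * B)      ≈⟨ interchange α A β B ⟩
    (α * β) * (A * B)      ≈⟨ *-cong (select-* (e zero) (f zero) (N zero)) (prodSel-* (e ∘ suc) (f ∘ suc) (N ∘ suc)) ⟩
    (γ * δ ²) * (X * C ²)  ≈⟨ interchange γ (δ ²) X (C ²) ⟩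
    (γ * X) * (δ ² * C ²)  ≈⟨ *-congˡ (interchange δ C δ C) ⟨
    (γ * X) * (δ * C) ²    ∎
    where
    α β γ δ A B X C : Carrier
    α = select (e zero) (N zero)
    β = select (f zero) (N zero)
    γ = select (e zero xor f zero) (N zero)
    δ = select (e zero ∧ f zero) (N zero)
    A = prodSel (e ∘ suc) (N ∘ suc)
    B = prodSel (f ∘ suc) (N ∘ suc)
    X = prodSel (λ i → e (suc i) xor f (suc i)) (N ∘ suc)
    C = prodSel (λ i → e (suc i) ∧ f (suc i)) (N ∘ suc)

  prodSel-cong : ∀ {ℓ} {e f : Fin ℓ → Bool} (N : Fin ℓ → Carrier) → (∀ i → e i ≡ f i) → prodSel e N ≈ prodSel f N
  prodSel-cong {zero}  N e≗f = refl
  prodSel-cong {suc ℓ} N e≗f rewrite e≗f zero = *-congˡ (prodSel-cong (N ∘ suc) (e≗f ∘ suc))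

  xor≢true⇒≡ : ∀ a b → ¬ (a xor b ≡ true) → a ≡ b
  xor≢true⇒≡ true  true  _ = ≡.refl
  xor≢true⇒≡ false false _ = ≡.refl
  xor≢true⇒≡ true  false h = ⊥-elim (h ≡.refl)
  xor≢true⇒≡ false true  h = ⊥-elim (h ≡.refl)

  module _ {ℓ} (N : Fin ℓ → Carrier) (¬square : ∀ x → InS2 N x → ¬ IsSquare x) where

    InS2-IsNegSquare-unique : ∀ x y → InS2 N x → IsNegSquare x → InS2 N y → IsNegSquare y → x ≈ y
    InS2-IsNegSquare-unique x y x∈S@(e , _ , x≈Ne) (a , x≈-a²) y∈S@(f , _ , y≈Nf) (b , y≈-b²)
      with any? (λ i → e i xor f i ≟ true)
    ... | no ¬differ = begin
      x            ≈⟨ x≈Ne ⟩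
      prodSel e N  ≈⟨ prodSel-cong N (λ i → xor≢true⇒≡ (e i) (f i) (λ h → ¬differ (i , h))) ⟩
      prodSel f N  ≈⟨ y≈Nf ⟨
      y            ∎
    ... | yes differ = ⊥-elim (IsSquare-*²⇒¬¬IsSquare C≉0 (a * b , XC²≈[ab]²) (¬square X (_ , differ , refl)))
      where
      X C : Carrier
      X = prodSel (λ i → e i xor f i) N
      C = prodSel (λ i → e i ∧ f i) N
      xy≈XC² : x * y ≈ X * C ²
      xy≈XC² = trans (*-cong x≈Ne y≈Nf) (prodSel-* e f N)
      XC²≈[ab]² : X * C ² ≈ (a * b) ²
      XC²≈[ab]² = begin
        X * C ²        ≈⟨ xy≈XC² ⟨
        x * y          ≈⟨ *-cong x≈-a² y≈-b² ⟩
        - a ² * - b ²  ≈⟨ -x*-y≈x*y (a ²) (b ²) ⟩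
        a ² * b ²      ≈⟨ interchange a a b b ⟩
        (a * b) ²      ∎
      C≉0 : C ≉ 0#
      C≉0 C≈0 = *-≉0 (¬IsSquare⇒≉0 (¬square x x∈S)) (¬IsSquare⇒≉0 (¬square y y∈S)) (begin
        x * y          ≈⟨ xy≈XC² ⟩
        X * C ²        ≈⟨ *-congˡ (trans (*-congʳ C≈0) (zeroˡ C)) ⟩
        X * 0#         ≈⟨ zeroʳ X ⟩
        0#             ∎)

    InS2-¬IsNegSquare : MinusOneSquareInFrac → ∀ x → InS2 N x → ¬ IsNegSquare x
    InS2-¬IsNegSquare (a , b , b≉0 , a²≈-b²) x x∈S (d , x≈-d²) =
      IsSquare-*²⇒¬¬IsSquare b≉0 (d * a , (begin
        x * b ²        ≈⟨ *-congʳ x≈-d² ⟩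
        - d ² * b ²    ≈⟨ -‿distribˡ-* (d ²) (b ²) ⟨
        - (d ² * b ²)  ≈⟨ -‿distribʳ-* (d ²) (b ²) ⟩
        d ² * - b ²    ≈⟨ *-congˡ a²≈-b² ⟨
        d ² * a ²      ≈⟨ interchange d d a a ⟩
        (d * a) ²      ∎)) (¬square x x∈S)

lemma5 : ∀ {c r} (R : CommutativeRing c r) → RingDefs.IsUFD R →
           (ℓ : ℕ) (N : Fin ℓ → CommutativeRing.Carrier R) →
           (∀ x → RingDefs.InS2 R N x → ¬ RingDefs.IsSquare R x) →
           (∀ x y → RingDefs.InS2 R N x → RingDefs.IsNegSquare R x →
              RingDefs.InS2 R N y → RingDefs.IsNegSquare R y →
              CommutativeRing._≈_ R x y)
           × (RingDefs.MinusOneSquareInFrac R →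
              ∀ x → RingDefs.InS2 R N x → ¬ RingDefs.IsNegSquare R x)
lemma5 R ufd ℓ N ¬square = InS2-IsNegSquare-unique N ¬square , InS2-¬IsNegSquare N ¬square
  where open UniqueFactorisationDomain R ufd
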